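{- For all integers $\ell\geqslant 1$ and $p,q\geqslant 2$, $$ex(p,q,K_{3,\ell})\leqslant (\ell-1)(p-2)+2q.$$
   Context: All graphs are simple. An ordered bipartite graph $(G;A,B)$ is a bipartite graph $G$ whose vertex set is partitioned into independent sets $A$ and $B$, each equipped with a linear order. Two vertices $u<v$ of the same part are consecutive if no vertex $w$ of that part satisfies $u<w<v$. Identifying two consecutive vertices $u,v$ replaces them by a single vertex $w$ (in their place in the order) whose neighbourhood is the union of the neighbourhoods of $u$ and $v$. Two ordered bipartite graphs are isomorphic if there is a graph isomorphism between them that maps parts to parts (possibly exchanging the two parts) and preserves both linear orders. An ordered bipartite graph $H$ is an interval minor of $G$ if a graph isomorphic to $H$ can be obtained from $G$ by repeatedly deleting edges and identifying consecutive vertices; otherwise $G$ is $H$-interval minor free. $ex(p,q,H)$ denotes the maximum number of edges of an ordered bipartite graph with parts of sizes $p$ and $q$ (first part of size $p$, second of size $q$) that is $H$-interval minor free; $K_{3,\ell}$ is the complete bipartite graph with parts of sizes $3$ and $\ell$. -}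

module Defs where

open import Data.Nat using (ℕ; zero; suc; _+_)
open import Data.Bool using (Bool; true; false; _∧_; _∨_; not; if_then_else_)
open import Data.Fin using (Fin; zero; suc; pinch; _<_)
import Data.Fin as Fin
open import Data.Product using (Σ; _×_; _,_)
open import Data.Sum using (_⊎_)
open import Relation.Nullary.Decidable using (⌊_⌋)
open import Relation.Binary.PropositionalEquality using (_≡_)
open import Function.Bundles using (Bijection; _⤖_)

-- An ordered bipartite graph: part A = Fin a, part B = Fin b, each ordered
-- by the natural order of Fin; adjacency is a Boolean relation A × B.
record OBG : Set where
  constructor obg
  field
    a : ℕ
    b : ℕ
    adj : Fin a → Fin b → Bool

anyFin : ∀ {n} → (Fin n → Bool) → Bool
anyFin {zero} f = false
anyFin {suc n} f = f zero ∨ anyFin (λ k → f (suc k))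

sumFin : ∀ {n} → (Fin n → ℕ) → ℕ
sumFin {zero} f = 0
sumFin {suc n} f = f zero + sumFin (λ k → f (suc k))

edges : OBG → ℕ
edges (obg a b adj) = sumFin (λ x → sumFin (λ y → if adj x y then 1 else 0))

deleteEdge : ∀ {a b} → Fin a → Fin b → (Fin a → Fin b → Bool) → (Fin a → Fin b → Bool)
deleteEdge x y adj u v = adj u v ∧ not (⌊ u Fin.≟ x ⌋ ∧ ⌊ v Fin.≟ y ⌋)

-- identify the consecutive vertices i and i+1 of part A (of size suc a);
-- pinch i : Fin (suc a) → Fin a collapses exactly i and i+1 (order preserving)
mergeA : ∀ {a b} → Fin a → (Fin (suc a) → Fin b → Bool) → (Fin a → Fin b → Bool)
mergeA i adj k y = anyFin (λ v → ⌊ pinch i v Fin.≟ k ⌋ ∧ adj v y)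

mergeB : ∀ {a b} → Fin b → (Fin a → Fin (suc b) → Bool) → (Fin a → Fin b → Bool)
mergeB j adj x k = anyFin (λ w → ⌊ pinch j w Fin.≟ k ⌋ ∧ adj x w)

infix 4 _⇝_
data _⇝_ : OBG → OBG → Set where
  done : ∀ {G} → G ⇝ G
  del  : ∀ {a b} (adj : Fin a → Fin b → Bool) (x : Fin a) (y : Fin b) {H} →
         obg a b (deleteEdge x y adj) ⇝ H → obg a b adj ⇝ H
  idA  : ∀ {a b} (adj : Fin (suc a) → Fin b → Bool) (i : Fin a) {H} →
         obg a b (mergeA i adj) ⇝ H → obg (suc a) b adj ⇝ H
  idB  : ∀ {a b} (adj : Fin a → Fin (suc b) → Bool) (j : Fin b) {H} →
         obg a b (mergeB j adj) ⇝ H → obg a (suc b) adj ⇝ H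

OrdBij : ℕ → ℕ → Set
OrdBij m n = Σ (Fin m ⤖ Fin n) λ σ →
  ∀ x y → x < y → Bijection.to σ x < Bijection.to σ y

Iso : OBG → OBG → Set
Iso (obg a b f) (obg a' b' g) =
  (Σ (OrdBij a a') λ σ → Σ (OrdBij b b') λ τ →
     ∀ x y → f x y ≡ g (Bijection.to (Data.Product.proj₁ σ) x)
                       (Bijection.to (Data.Product.proj₁ τ) y))
  ⊎
  (Σ (OrdBij a b') λ σ → Σ (OrdBij b a') λ τ →
     ∀ x y → f x y ≡ g (Bijection.to (Data.Product.proj₁ τ) y)
                       (Bijection.to (Data.Product.proj₁ σ) x))
  where import Data.Product

IntervalMinor : OBG → OBG → Set
IntervalMinor H G = Σ OBG λ G' → (G ⇝ G') × Iso G' H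

K : ℕ → ℕ → OBG
K m n = obg m n (λ _ _ → true)

-- In each column, every edge except the topmost and the bottommost one is
-- interior: it has an edge of its column strictly above and strictly below.
-- Hence the number of edges is at most 2q plus the number of interior edges.
-- A row carrying ℓ interior edges yields K_{3,ℓ}: identify all rows above it,
-- and all rows below it, into one row each, and identify the columns into ℓ
-- consecutive blocks each containing one of these interior edges.  So in a
-- K_{3,ℓ}-free graph every row carries at most ℓ - 1 interior edges, and the
-- first and last rows carry none.
module Submission where

open import Defs
open import Data.Nat using (ℕ; _≤_; _*_; _+_; _∸_)
open import Data.Fin using (Fin)
open import Data.Bool using (Bool)
open import Relation.Nullary using (¬_)

open import Data.Bool using (true; false; _∧_; _∨_; not; if_then_else_)
open import Data.Bool.Properties using (∧-zeroʳ; ∨-zeroʳ; ∨-conicalˡ; ∨-conicalʳ)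
open import Data.Fin using (zero; suc; toℕ; inject₁; fromℕ; punchIn; pinch; _≟_)
open import Data.Fin.Induction using (<-weakInduction)
open import Data.Fin.Patterns using (0F; 1F; 2F)
open import Data.Fin.Properties using (any?; toℕ-injective; toℕ-inject₁; toℕ-fromℕ; toℕ<n; toℕ≤pred[n])
open import Data.Nat using (zero; suc; _<_; z≤n; s≤s; s≤s⁻¹)
open import Data.Nat.Properties
  using (+-0-commutativeMonoid; +-identityʳ; +-comm; +-assoc; *-comm; ≤-refl; ≤-reflexive; ≤-trans; <-≤-trans;
         +-mono-≤; +-monoˡ-≤; +-monoʳ-≤; ≮⇒≥; module ≤-Reasoning)
open import Algebra.Properties.CommutativeMonoid.Sum +-0-commutativeMonoid
  using (sum; sum-syntax; ∑-comm; ∑-distrib-+; sum-cong-≗; sum-replicate-zero; sum-init-last)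
open import Data.Product using (∃; ∃₂; _×_; _,_; proj₁; proj₂)
open import Data.Sum using (_⊎_; inj₁; inj₂)
open import Data.Vec.Functional using (init; tail)
open import Function using (_∘_; flip)
open import Function.Construct.Identity using (⤖-id)
open import Relation.Binary.PropositionalEquality
  using (_≡_; refl; sym; trans; cong; cong₂; subst; subst₂; module ≡-Reasoning)
open import Relation.Nullary using (yes; no; contradiction)
open import Relation.Nullary.Decidable using (⌊_⌋; isYes≗does; dec-true)

bit : Bool → ℕ
bit b = if b then 1 else 0

bit≤1 : ∀ b → bit b ≤ 1
bit≤1 true  = ≤-refl
bit≤1 false = z≤n

count : ∀ {n} → (Fin n → Bool) → ℕ
count f = sum (bit ∘ f)

∧-true⁻ : ∀ {a b} → a ∧ b ≡ true → a ≡ true × b ≡ true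
∧-true⁻ {true} {true} _ = refl , refl

anyFin⁺ : ∀ {n} (f : Fin n → Bool) x → f x ≡ true → anyFin f ≡ true
anyFin⁺ f zero    fx rewrite fx = refl
anyFin⁺ f (suc x) fx rewrite anyFin⁺ (f ∘ suc) x fx = ∨-zeroʳ (f zero)

anyFin⁻ : ∀ {n} (f : Fin n → Bool) → anyFin f ≡ true → ∃ λ x → f x ≡ true
anyFin⁻ {suc n} f any with f zero in f0
... | true  = zero , f0
... | false = let x , fx = anyFin⁻ (f ∘ suc) any in suc x , fx

anyFin-false⁻ : ∀ {n} (f : Fin n → Bool) → anyFin f ≡ false → ∀ x → f x ≡ false
anyFin-false⁻ f none zero    = ∨-conicalˡ _ _ none
anyFin-false⁻ f none (suc x) = anyFin-false⁻ (f ∘ suc) (∨-conicalʳ _ _ none) x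

count≡0 : ∀ {n} (f : Fin n → Bool) → (∀ x → f x ≡ false) → count f ≡ 0
count≡0 {n} f none = trans (sum-cong-≗ (cong bit ∘ none)) (sum-replicate-zero n)

sumFin≡sum : ∀ {n} (f : Fin n → ℕ) → sumFin f ≡ sum f
sumFin≡sum {zero}  f = refl
sumFin≡sum {suc n} f = cong (f zero +_) (sumFin≡sum (f ∘ suc))

sum-mono-≤ : ∀ {n} {f g : Fin n → ℕ} → (∀ x → f x ≤ g x) → sum f ≤ sum g
sum-mono-≤ {zero}  _   = z≤n
sum-mono-≤ {suc n} f≤g = +-mono-≤ (f≤g zero) (sum-mono-≤ (f≤g ∘ suc))

sum-const : ∀ n c → sum {n} (λ _ → c) ≡ n * c
sum-const zero    c = refl
sum-const (suc n) c = cong (c +_) (sum-const n c)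

sum-≤-vanishingEnds : ∀ {n c} (f : Fin (suc (suc n)) → ℕ) → (∀ x → f x ≤ c) →
  f zero ≡ 0 → f (fromℕ (suc n)) ≡ 0 → sum f ≤ n * c
sum-≤-vanishingEnds {n} {c} f f≤c first last = begin
  sum f                                    ≡⟨ cong (_+ sum (tail f)) first ⟩
  sum (tail f)                             ≡⟨ sum-init-last (tail f) ⟩
  sum (init (tail f)) + f (fromℕ (suc n))  ≡⟨ cong (sum (init (tail f)) +_) last ⟩
  sum (init (tail f)) + 0                  ≡⟨ +-identityʳ _ ⟩
  sum (init (tail f))                      ≤⟨ sum-mono-≤ (λ x → f≤c (suc (inject₁ x))) ⟩
  sum {n} (λ _ → c)                        ≡⟨ sum-const n c ⟩
  n * c                                    ∎
  where open ≤-Reasoning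

-- Interval minors from block partitions

⇝-trans : ∀ {G H I} → G ⇝ H → H ⇝ I → G ⇝ I
⇝-trans done              H⇝I = H⇝I
⇝-trans (del adj x y G⇝H) H⇝I = del adj x y (⇝-trans G⇝H H⇝I)
⇝-trans (idA adj i G⇝H)   H⇝I = idA adj i (⇝-trans G⇝H H⇝I)
⇝-trans (idB adj j G⇝H)   H⇝I = idB adj j (⇝-trans G⇝H H⇝I)

infix 4 _⇝ᵣ_
data _⇝ᵣ_ {b} : ∀ {m n} → (Fin m → Fin b → Bool) → (Fin n → Fin b → Bool) → Set where
  []  : ∀ {m} {f : Fin m → Fin b → Bool} → f ⇝ᵣ f
  _∷_ : ∀ {m n} {f : Fin (suc m) → Fin b → Bool} {g : Fin n → Fin b → Bool}
        (i : Fin m) → mergeA i f ⇝ᵣ g → f ⇝ᵣ g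

⇝ᵣ⇒⇝ : ∀ {m n b} {f : Fin m → Fin b → Bool} {g : Fin n → Fin b → Bool} →
  f ⇝ᵣ g → obg m b f ⇝ obg n b g
⇝ᵣ⇒⇝ []          = done
⇝ᵣ⇒⇝ (i ∷ f⇝ᵣg) = idA _ i (⇝ᵣ⇒⇝ f⇝ᵣg)

-- Typechecks because mergeB i (flip f) is definitionally flip (mergeA i f).
⇝ᵣ⇒⇝ᵀ : ∀ {m n b} {f : Fin m → Fin b → Bool} {g : Fin n → Fin b → Bool} →
  f ⇝ᵣ g → obg b m (flip f) ⇝ obg b n (flip g)
⇝ᵣ⇒⇝ᵀ []          = done
⇝ᵣ⇒⇝ᵀ (i ∷ f⇝ᵣg) = idB _ i (⇝ᵣ⇒⇝ᵀ f⇝ᵣg)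

mergeA⁺ : ∀ {m b} (i : Fin m) (f : Fin (suc m) → Fin b → Bool) {x y} →
  f x y ≡ true → mergeA i f (pinch i x) y ≡ true
mergeA⁺ i f {x} {y} fxy =
  anyFin⁺ (λ v → ⌊ pinch i v ≟ pinch i x ⌋ ∧ f v y) x (trans (cong (_∧ f x y) diagonal) fxy)
  where
  diagonal : ⌊ pinch i x ≟ pinch i x ⌋ ≡ true
  diagonal = trans (isYes≗does (pinch i x ≟ pinch i x)) (dec-true (pinch i x ≟ pinch i x) refl)

UnitStep : ∀ {n} → Fin n → Fin n → Set
UnitStep u v = toℕ v ≡ toℕ u ⊎ toℕ v ≡ suc (toℕ u)

record MonotoneSurjection {m n} (α : Fin (suc m) → Fin (suc n)) : Set where
  field
    starts : α zero ≡ zero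
    steps  : ∀ j → UnitStep (α (inject₁ j)) (α (suc j))
    ends   : α (fromℕ m) ≡ fromℕ n

Repeats : ∀ {m} {B : Set} → (Fin (suc m) → B) → Fin m → Set
Repeats α k = α (suc k) ≡ α (inject₁ k)

punchIn∘pinch-invariant : ∀ {m} {B : Set} (k : Fin (suc m)) (α : Fin (suc (suc m)) → B) →
  Repeats α k → ∀ x → α (punchIn (suc k) (pinch k x)) ≡ α x
punchIn∘pinch-invariant k       α repeat zero          = refl
punchIn∘pinch-invariant zero    α repeat (suc zero)    = sym repeat
punchIn∘pinch-invariant zero    α repeat (suc (suc x)) = refl
punchIn∘pinch-invariant {suc m} (suc k) α repeat (suc x) =
  punchIn∘pinch-invariant k (α ∘ suc) repeat x

pinch-fromℕ : ∀ {m} (k : Fin (suc m)) → pinch k (fromℕ (suc m)) ≡ fromℕ m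
pinch-fromℕ         zero    = refl
pinch-fromℕ {suc m} (suc k) = cong suc (pinch-fromℕ k)

punchIn-unitSteps : ∀ {m n} (k : Fin (suc m)) (α : Fin (suc (suc m)) → Fin n) →
  (∀ j → UnitStep (α (inject₁ j)) (α (suc j))) → Repeats α k →
  ∀ j → UnitStep (α (punchIn (suc k) (inject₁ j))) (α (punchIn (suc k) (suc j)))
punchIn-unitSteps zero α steps repeat zero =
  subst (λ u → UnitStep u (α 2F)) repeat (steps 1F)
punchIn-unitSteps zero    α steps repeat (suc j) = steps (suc (suc j))
punchIn-unitSteps (suc k) α steps repeat zero    = steps zero
punchIn-unitSteps {suc m} (suc k) α steps repeat (suc j) =
  punchIn-unitSteps k (α ∘ suc) (steps ∘ suc) repeat j

MonotoneSurjection-punchIn : ∀ {m n} {α : Fin (suc (suc m)) → Fin (suc n)} {k} →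
  MonotoneSurjection α → Repeats α k → MonotoneSurjection (α ∘ punchIn (suc k))
MonotoneSurjection-punchIn {m} {n} {α} {k} S repeat = record
  { starts = starts
  ; steps  = punchIn-unitSteps k α steps repeat
  ; ends   = begin
      α (punchIn (suc k) (fromℕ m))                  ≡⟨ cong (α ∘ punchIn (suc k)) (sym (pinch-fromℕ k)) ⟩
      α (punchIn (suc k) (pinch k (fromℕ (suc m))))  ≡⟨ punchIn∘pinch-invariant k α repeat _ ⟩
      α (fromℕ (suc m))                              ≡⟨ ends ⟩
      fromℕ n                                        ∎
  }
  where
  open MonotoneSurjection S
  open ≡-Reasoning

repeatFree⇒toℕ-id : ∀ {m n} {α : Fin (suc m) → Fin (suc n)} → MonotoneSurjection α →
  (∀ k → ¬ Repeats α k) → ∀ x → toℕ (α x) ≡ toℕ x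
repeatFree⇒toℕ-id {α = α} S repeatFree = <-weakInduction (λ x → toℕ (α x) ≡ toℕ x) (cong toℕ starts) step
  where
  open MonotoneSurjection S
  step : ∀ k → toℕ (α (inject₁ k)) ≡ toℕ (inject₁ k) → toℕ (α (suc k)) ≡ suc (toℕ k)
  step k ih with steps k
  ... | inj₁ same = contradiction (toℕ-injective same) (repeatFree k)
  ... | inj₂ next = trans next (cong suc (trans ih (toℕ-inject₁ k)))

repeatFree⇒sizes≡ : ∀ {m n} {α : Fin (suc m) → Fin (suc n)} → MonotoneSurjection α →
  (∀ k → ¬ Repeats α k) → m ≡ n
repeatFree⇒sizes≡ {m} {n} {α} S repeatFree = begin
  m                    ≡⟨ sym (toℕ-fromℕ m) ⟩
  toℕ (fromℕ m)        ≡⟨ sym (repeatFree⇒toℕ-id S repeatFree (fromℕ m)) ⟩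
  toℕ (α (fromℕ m))    ≡⟨ cong toℕ (MonotoneSurjection.ends S) ⟩
  toℕ (fromℕ n)        ≡⟨ toℕ-fromℕ n ⟩
  n                    ∎
  where open ≡-Reasoning

Collapse : ∀ {m n b} → (Fin m → Fin b → Bool) → (Fin m → Fin n) → Set
Collapse {n = n} {b} f α =
  ∃ λ (g : Fin n → Fin b → Bool) → f ⇝ᵣ g × (∀ {x y} → f x y ≡ true → g (α x) y ≡ true)

collapse-repeatFree : ∀ {m n b} (f : Fin (suc m) → Fin b → Bool) {α : Fin (suc m) → Fin (suc n)} →
  MonotoneSurjection α → (∀ k → ¬ Repeats α k) → Collapse f α
collapse-repeatFree f S repeatFree with repeatFree⇒sizes≡ S repeatFree
... | refl = f , [] , λ {x} {y} fxy →
  subst (λ u → f u y ≡ true) (toℕ-injective (sym (repeatFree⇒toℕ-id S repeatFree x))) fxy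

collapseRows : ∀ {m n b} (f : Fin (suc m) → Fin b → Bool) {α : Fin (suc m) → Fin (suc n)} →
  MonotoneSurjection α → Collapse f α
collapseRows f {α} S with any? (λ k → α (suc k) ≟ α (inject₁ k))
collapseRows {zero} f S | yes (() , _)
collapseRows {suc m} f {α} S | yes (k , repeat) =
  let g , merges , preserves = collapseRows (mergeA k f) (MonotoneSurjection-punchIn S repeat)
  in  g , k ∷ merges ,
      λ {x} {y} fxy → subst (λ u → g u y ≡ true) (punchIn∘pinch-invariant k α repeat x)
                            (preserves (mergeA⁺ k f fxy))
collapseRows f S | no noRepeat = collapse-repeatFree f S (λ k repeat → noRepeat (k , repeat))

idOrdBij : ∀ {n} → OrdBij n n
idOrdBij {n} = ⤖-id (Fin n) , λ _ _ x<y → x<y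

complete⇒Iso-K : ∀ {m n} (h : Fin m → Fin n → Bool) → (∀ x y → h x y ≡ true) → Iso (obg m n h) (K m n)
complete⇒Iso-K h complete = inj₁ (idOrdBij , idOrdBij , complete)

blocksHit⇒K-minor : ∀ {p q a b} (adj : Fin (suc p) → Fin (suc q) → Bool)
  {α : Fin (suc p) → Fin (suc a)} {β : Fin (suc q) → Fin (suc b)} →
  MonotoneSurjection α → MonotoneSurjection β →
  (∀ k m → ∃₂ λ r y → adj r y ≡ true × α r ≡ k × β y ≡ m) →
  IntervalMinor (K (suc a) (suc b)) (obg (suc p) (suc q) adj)
blocksHit⇒K-minor adj Sα Sβ hit =
  let h₁ , rowMerges    , α-preserves = collapseRows adj Sα
      h₂ , columnMerges , β-preserves = collapseRows (flip h₁) Sβ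
  in  obg _ _ (flip h₂) , ⇝-trans (⇝ᵣ⇒⇝ rowMerges) (⇝ᵣ⇒⇝ᵀ columnMerges) ,
      complete⇒Iso-K _ λ k m →
        let r , y , ary , αr≡k , βy≡m = hit k m
        in  subst₂ (λ u v → h₂ v u ≡ true) αr≡k βy≡m (β-preserves (α-preserves ary))

-- The row and column blocks of the minor

side : ℕ → ℕ → Fin 3
side zero    zero    = 1F
side zero    (suc _) = 2F
side (suc _) zero    = 0F
side (suc t) (suc z) = side t z

side-< : ∀ {t z} → z < t → side t z ≡ 0F
side-< {suc t} {zero}  _         = refl
side-< {suc t} {suc z} (s≤s z<t) = side-< z<t

side-≡ : ∀ t → side t t ≡ 1F
side-≡ zero    = refl
side-≡ (suc t) = side-≡ t

side-> : ∀ {t z} → t < z → side t z ≡ 2F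
side-> {zero}  {suc z} _         = refl
side-> {suc t} {suc z} (s≤s t<z) = side-> t<z

side-unitStep : ∀ t z → UnitStep (side t z) (side t (suc z))
side-unitStep zero          zero    = inj₂ refl
side-unitStep zero          (suc z) = inj₁ refl
side-unitStep (suc zero)    zero    = inj₂ refl
side-unitStep (suc (suc t)) zero    = inj₁ refl
side-unitStep (suc t)       (suc z) = side-unitStep t z

side-monotoneSurjection : ∀ {m t} → 0 < t → t < m →
  MonotoneSurjection {m} (side t ∘ toℕ)
side-monotoneSurjection {m} {t} 0<t t<m = record
  { starts = side-< 0<t
  ; steps  = λ j → subst (λ z → UnitStep (side t z) (side t (suc (toℕ j))))
                         (sym (toℕ-inject₁ j)) (side-unitStep t (toℕ j))
  ; ends   = side-> (subst (t <_) (sym (toℕ-fromℕ m)) t<m)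
  }

clamp : (c : ℕ) → ℕ → Fin (suc c)
clamp zero    _       = zero
clamp (suc c) zero    = zero
clamp (suc c) (suc n) = suc (clamp c n)

clamp-zero : ∀ c → clamp c 0 ≡ zero
clamp-zero zero    = refl
clamp-zero (suc c) = refl

clamp-≥ : ∀ {c n} → c ≤ n → clamp c n ≡ fromℕ c
clamp-≥ {zero}          _         = refl
clamp-≥ {suc c} {suc n} (s≤s c≤n) = cong suc (clamp-≥ c≤n)

clamp-toℕ : ∀ {c} (m : Fin (suc c)) → clamp c (toℕ m) ≡ m
clamp-toℕ {zero}  zero    = refl
clamp-toℕ {suc c} zero    = refl
clamp-toℕ {suc c} (suc m) = cong suc (clamp-toℕ m)

clamp-unitStep : ∀ c n → UnitStep (clamp c n) (clamp c (suc n))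
clamp-unitStep zero    n       = inj₁ refl
clamp-unitStep (suc c) zero    = inj₂ (cong (suc ∘ toℕ) (clamp-zero c))
clamp-unitStep (suc c) (suc n) with clamp-unitStep c n
... | inj₁ same = inj₁ (cong suc same)
... | inj₂ next = inj₂ (cong suc next)

clamp-unitStep-bit : ∀ c n b → UnitStep (clamp c n) (clamp c (n + bit b))
clamp-unitStep-bit c n false rewrite +-identityʳ n = inj₁ refl
clamp-unitStep-bit c n true  rewrite +-comm n 1    = clamp-unitStep c n

prefixCount : ∀ {n} → (Fin n → Bool) → Fin n → ℕ
prefixCount g zero    = 0
prefixCount g (suc y) = bit (g zero) + prefixCount (g ∘ suc) y

prefixCount-suc : ∀ {n} (g : Fin (suc n) → Bool) y →
  prefixCount g (suc y) ≡ prefixCount g (inject₁ y) + bit (g (inject₁ y))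
prefixCount-suc g zero    = +-identityʳ _
prefixCount-suc g (suc y) =
  trans (cong (bit (g zero) +_) (prefixCount-suc (g ∘ suc) y)) (sym (+-assoc (bit (g zero)) _ _))

count≡prefixCount-fromℕ : ∀ {n} (g : Fin (suc n) → Bool) →
  count g ≡ prefixCount g (fromℕ n) + bit (g (fromℕ n))
count≡prefixCount-fromℕ {zero}  g = +-identityʳ _
count≡prefixCount-fromℕ {suc n} g =
  trans (cong (bit (g zero) +_) (count≡prefixCount-fromℕ (g ∘ suc))) (sym (+-assoc (bit (g zero)) _ _))

prefixCount-hits : ∀ {n} (g : Fin n → Bool) m → m < count g →
  ∃ λ y → g y ≡ true × prefixCount g y ≡ m
prefixCount-hits {suc n} g m m<count with g zero in g0
prefixCount-hits {suc n} g zero    _             | true = zero , g0 , refl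
prefixCount-hits {suc n} g (suc m) (s≤s m<count) | true =
  let y , gy , prefix≡m = prefixCount-hits (g ∘ suc) m m<count
  in  suc y , gy , trans (cong (λ b → bit b + prefixCount (g ∘ suc) y) g0) (cong suc prefix≡m)
prefixCount-hits {suc n} g m       m<count       | false =
  let y , gy , prefix≡m = prefixCount-hits (g ∘ suc) m m<count
  in  suc y , gy , trans (cong (λ b → bit b + prefixCount (g ∘ suc) y) g0) prefix≡m

clamp∘prefixCount-monotoneSurjection : ∀ {n c} (g : Fin (suc n) → Bool) → c < count g →
  MonotoneSurjection (clamp c ∘ prefixCount g)
clamp∘prefixCount-monotoneSurjection {n} {c} g c<count = record
  { starts = clamp-zero c
  ; steps  = λ j → subst (λ k → UnitStep (clamp c (prefixCount g (inject₁ j))) (clamp c k))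
                         (sym (prefixCount-suc g j)) (clamp-unitStep-bit c _ (g (inject₁ j)))
  ; ends   = clamp-≥ (s≤s⁻¹ (begin
      suc c                                              ≤⟨ c<count ⟩
      count g                                            ≡⟨ count≡prefixCount-fromℕ g ⟩
      prefixCount g (fromℕ n) + bit (g (fromℕ n))        ≤⟨ +-monoʳ-≤ _ (bit≤1 (g (fromℕ n))) ⟩
      prefixCount g (fromℕ n) + 1                        ≡⟨ +-comm _ 1 ⟩
      suc (prefixCount g (fromℕ n))                      ∎))
  }
  where open ≤-Reasoning

-- Interior edges

trueBefore : ∀ {n} → (Fin n → Bool) → Fin n → Bool
trueBefore f zero    = false
trueBefore f (suc x) = f zero ∨ trueBefore (f ∘ suc) x

trueAfter : ∀ {n} → (Fin n → Bool) → Fin n → Bool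
trueAfter f zero    = anyFin (f ∘ suc)
trueAfter f (suc x) = trueAfter (f ∘ suc) x

interior : ∀ {n} → (Fin n → Bool) → Fin n → Bool
interior f x = f x ∧ (trueBefore f x ∧ trueAfter f x)

trueBefore⁻ : ∀ {n} (f : Fin n → Bool) x → trueBefore f x ≡ true →
  ∃ λ w → f w ≡ true × toℕ w < toℕ x
trueBefore⁻ f (suc x) before with f zero in f0
... | true  = zero , f0 , s≤s z≤n
... | false = let w , fw , w<x = trueBefore⁻ (f ∘ suc) x before in suc w , fw , s≤s w<x

trueAfter⁻ : ∀ {n} (f : Fin n → Bool) x → trueAfter f x ≡ true →
  ∃ λ w → f w ≡ true × toℕ x < toℕ w
trueAfter⁻ f zero    after = let w , fw = anyFin⁻ (f ∘ suc) after in suc w , fw , s≤s z≤n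
trueAfter⁻ f (suc x) after = let w , fw , x<w = trueAfter⁻ (f ∘ suc) x after in suc w , fw , s≤s x<w

interior⁻ : ∀ {n} (f : Fin n → Bool) x → interior f x ≡ true →
  f x ≡ true × (∃ λ w → f w ≡ true × toℕ w < toℕ x) × (∃ λ w → f w ≡ true × toℕ x < toℕ w)
interior⁻ f x inner =
  let fx , around = ∧-true⁻ inner
      before , after = ∧-true⁻ around
  in  fx , trueBefore⁻ f x before , trueAfter⁻ f x after

interior⇒inner : ∀ {n} (f : Fin (suc n) → Bool) x → interior f x ≡ true → 0 < toℕ x × toℕ x < n
interior⇒inner f x inner =
  let _ , (_ , _ , w<x) , (w , _ , x<w) = interior⁻ f x inner
  in  ≤-trans (s≤s z≤n) w<x , <-≤-trans x<w (toℕ≤pred[n] w)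

interior⇒side-hit : ∀ {n} (f : Fin n → Bool) x → interior f x ≡ true →
  ∀ k → ∃ λ r → f r ≡ true × side (toℕ x) (toℕ r) ≡ k
interior⇒side-hit f x inner k with interior⁻ f x inner | k
... | _  , (w , fw , w<x) , _ | 0F = w , fw , side-< w<x
... | fx , _              , _ | 1F = x , fx , side-≡ (toℕ x)
... | _  , _ , (w , fw , x<w) | 2F = w , fw , side-> x<w

trueAfter-fromℕ : ∀ {n} (f : Fin (suc n) → Bool) → trueAfter f (fromℕ n) ≡ false
trueAfter-fromℕ {zero}  f = refl
trueAfter-fromℕ {suc n} f = trueAfter-fromℕ (f ∘ suc)

interior-zero : ∀ {n} (f : Fin (suc n) → Bool) → interior f zero ≡ false
interior-zero f = ∧-zeroʳ (f zero)

interior-fromℕ : ∀ {n} (f : Fin (suc n) → Bool) → interior f (fromℕ n) ≡ false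
interior-fromℕ {n} f rewrite trueAfter-fromℕ f | ∧-zeroʳ (trueBefore f (fromℕ n)) = ∧-zeroʳ (f (fromℕ n))

count-first : ∀ {n} (f : Fin n → Bool) → count (λ x → f x ∧ not (trueBefore f x)) ≤ 1
count-first {zero}  f = z≤n
count-first {suc n} f with f zero
... | true  = ≤-reflexive (cong suc (count≡0 _ (λ x → ∧-zeroʳ (f (suc x)))))
... | false = count-first (f ∘ suc)

count-last : ∀ {n} (f : Fin n → Bool) → count (λ x → f x ∧ not (trueAfter f x)) ≤ 1
count-last {zero}  f = z≤n
count-last {suc n} f with anyFin (f ∘ suc) in any
... | true  = +-mono-≤ (≤-reflexive (cong bit (∧-zeroʳ (f zero)))) (count-last (f ∘ suc))
... | false = +-mono-≤ (bit≤1 _) (≤-reflexive (count≡0 _ (λ x →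
                cong (_∧ not (trueAfter (f ∘ suc) x)) (anyFin-false⁻ (f ∘ suc) any x))))

bit-≤-first+last+interior : ∀ a b c → bit a ≤ bit (a ∧ not b) + bit (a ∧ not c) + bit (a ∧ (b ∧ c))
bit-≤-first+last+interior true  true  true  = ≤-refl
bit-≤-first+last+interior true  true  false = s≤s z≤n
bit-≤-first+last+interior true  false c     = s≤s z≤n
bit-≤-first+last+interior false b     c     = z≤n

count≤2+interior : ∀ {n} (f : Fin n → Bool) → count f ≤ 2 + count (interior f)
count≤2+interior {n} f = begin
  count f
    ≤⟨ sum-mono-≤ (λ x → bit-≤-first+last+interior (f x) (trueBefore f x) (trueAfter f x)) ⟩
  sum (λ x → bit (first x) + bit (last x) + bit (interior f x))
    ≡⟨ ∑-distrib-+ (λ x → bit (first x) + bit (last x)) (bit ∘ interior f) ⟩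
  sum (λ x → bit (first x) + bit (last x)) + count (interior f)
    ≡⟨ cong (_+ count (interior f)) (∑-distrib-+ (bit ∘ first) (bit ∘ last)) ⟩
  count first + count last + count (interior f)
    ≤⟨ +-monoˡ-≤ _ (+-mono-≤ (count-first f) (count-last f)) ⟩
  2 + count (interior f)
    ∎
  where
  open ≤-Reasoning
  first last : Fin n → Bool
  first x = f x ∧ not (trueBefore f x)
  last  x = f x ∧ not (trueAfter f x)

column : ∀ {p q} → (Fin p → Fin q → Bool) → Fin q → Fin p → Bool
column = flip

interiorDegree : ∀ {p q} → (Fin p → Fin q → Bool) → Fin p → ℕ
interiorDegree adj x = count (λ y → interior (column adj y) x)

interiorDegree⇒K3-minor : ∀ {p q c} (adj : Fin (suc p) → Fin (suc q) → Bool) x →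
  c < interiorDegree adj x → IntervalMinor (K 3 (suc c)) (obg (suc p) (suc q) adj)
interiorDegree⇒K3-minor {p} {q} {c} adj x c<degree =
  blocksHit⇒K-minor adj (side-monotoneSurjection (proj₁ x-inner) (proj₂ x-inner))
                        (clamp∘prefixCount-monotoneSurjection g c<degree) hit
  where
  g : Fin (suc q) → Bool
  g y = interior (column adj y) x
  columnWith : ∀ (m : Fin (suc c)) → ∃ λ y → g y ≡ true × prefixCount g y ≡ toℕ m
  columnWith m = prefixCount-hits g (toℕ m) (<-≤-trans (toℕ<n m) c<degree)
  x-inner : 0 < toℕ x × toℕ x < p
  x-inner = let y , gy , _ = columnWith zero in interior⇒inner (column adj y) x gy
  hit : ∀ k m → ∃₂ λ r y → adj r y ≡ true × side (toℕ x) (toℕ r) ≡ k × clamp c (prefixCount g y) ≡ m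
  hit k m =
    let y , gy , prefix≡m = columnWith m
        r , ary , side≡k  = interior⇒side-hit (column adj y) x gy k
    in  r , y , ary , side≡k , trans (cong (clamp c) prefix≡m) (clamp-toℕ m)

edges≤2q+∑interiorDegree : ∀ {p q} (adj : Fin p → Fin q → Bool) →
  edges (obg p q adj) ≤ q * 2 + ∑[ x < p ] interiorDegree adj x
edges≤2q+∑interiorDegree {p} {q} adj = begin
  edges (obg p q adj)
    ≡⟨ trans (sumFin≡sum (λ x → sumFin (bit ∘ adj x))) (sum-cong-≗ (λ x → sumFin≡sum (bit ∘ adj x))) ⟩
  ∑[ x < p ] ∑[ y < q ] bit (adj x y)
    ≡⟨ ∑-comm (λ x y → bit (adj x y)) ⟩
  ∑[ y < q ] count (column adj y)
    ≤⟨ sum-mono-≤ (λ y → count≤2+interior (column adj y)) ⟩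
  ∑[ y < q ] (2 + count (interior (column adj y)))
    ≡⟨ ∑-distrib-+ (λ _ → 2) (count ∘ interior ∘ column adj) ⟩
  ∑[ y < q ] 2 + ∑[ y < q ] ∑[ x < p ] bit (interior (column adj y) x)
    ≡⟨ cong₂ _+_ (sum-const q 2) (∑-comm (λ y x → bit (interior (column adj y) x))) ⟩
  q * 2 + ∑[ x < p ] interiorDegree adj x
    ∎
  where open ≤-Reasoning

interiorDegree-zero : ∀ {p q} (adj : Fin (suc p) → Fin q → Bool) → interiorDegree adj zero ≡ 0
interiorDegree-zero adj = count≡0 _ (λ y → interior-zero (column adj y))

interiorDegree-fromℕ : ∀ {p q} (adj : Fin (suc p) → Fin q → Bool) → interiorDegree adj (fromℕ p) ≡ 0
interiorDegree-fromℕ adj = count≡0 _ (λ y → interior-fromℕ (column adj y))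

lemma4p1 : (ℓ p q : ℕ) → 1 ≤ ℓ → 2 ≤ p → 2 ≤ q →
    (adj : Fin p → Fin q → Bool) →
    ¬ IntervalMinor (K 3 ℓ) (obg p q adj) →
    edges (obg p q adj) ≤ (ℓ ∸ 1) * (p ∸ 2) + 2 * q
lemma4p1 (suc c) (suc (suc p)) (suc (suc q)) (s≤s z≤n) (s≤s (s≤s z≤n)) (s≤s (s≤s z≤n)) adj noMinor =
  begin
    edges (obg _ _ adj)
      ≤⟨ edges≤2q+∑interiorDegree adj ⟩
    suc (suc q) * 2 + sum (interiorDegree adj)
      ≤⟨ +-monoʳ-≤ _ (sum-≤-vanishingEnds (interiorDegree adj) degree≤c
                        (interiorDegree-zero adj) (interiorDegree-fromℕ adj)) ⟩
    suc (suc q) * 2 + p * c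
      ≡⟨ trans (+-comm _ (p * c)) (cong₂ _+_ (*-comm p c) (*-comm (suc (suc q)) 2)) ⟩
    c * p + 2 * suc (suc q)
      ∎
  where
  open ≤-Reasoning
  degree≤c : ∀ x → interiorDegree adj x ≤ c
  degree≤c x = ≮⇒≥ (noMinor ∘ interiorDegree⇒K3-minor adj x)
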